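{- Let $a,b$ be relatively prime positive integers, and let $K_1(a,b)$ and $K_2(a,b)$ be ternary lattices with Gram matrices $$K_1(a,b)=\begin{pmatrix}2a&-a&-a\\-a&2a&0\\-a&0&b\end{pmatrix},\qquad K_2(a,b)=\begin{pmatrix}2a&-a&0\\-a&2a&0\\0&0&b\end{pmatrix},$$ (for $K_1(a,b)$ assume the matrix is positive definite). Then (a) $|O(K_2(a,b))|=24$; (b) $|O(K_1(a,b))|=12$ unless $(a,b)=(1,1),(1,2)$ or $(4,3)$.
   Context: Lattices are $\mathbb{Z}$-lattices on positive definite quadratic spaces over $\mathbb{Q}$; $O(K)$ denotes the isometry group. -}

module Defs where

open import Data.Nat using (ℕ)
open import Data.Integer using (ℤ; +_; -_; _+_; _*_; _<_; 0ℤ; 1ℤ)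
open import Data.Fin using (Fin; zero; suc)
open import Data.Vec using (Vec; []; _∷_; lookup; tabulate; transpose; replicate)
open import Data.List using (List; length)
open import Data.List.Membership.Propositional using (_∈_)
open import Data.List.Relation.Unary.Unique.Propositional using (Unique)
open import Data.Product using (Σ; _×_; ∃)
open import Relation.Binary.PropositionalEquality using (_≡_; _≢_)

-- 3×3 integer matrices, as vectors of rows (so that _≡_ is the right equality).
Mat : Set
Mat = Vec (Vec ℤ 3) 3

Vec3 : Set
Vec3 = Vec ℤ 3

entry : Mat → Fin 3 → Fin 3 → ℤ
entry M i j = lookup (lookup M i) j

sum3 : (Fin 3 → ℤ) → ℤ
sum3 f = f zero + f (suc zero) + f (suc (suc zero))

_·_ : Mat → Mat → Mat
M · N = tabulate λ i → tabulate λ j → sum3 λ k → entry M i k * entry N k j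

I₃ : Mat
I₃ = (1ℤ ∷ 0ℤ ∷ 0ℤ ∷ []) ∷ (0ℤ ∷ 1ℤ ∷ 0ℤ ∷ []) ∷ (0ℤ ∷ 0ℤ ∷ 1ℤ ∷ []) ∷ []

Q : Mat → Vec3 → ℤ
Q G x = sum3 λ i → sum3 λ j → lookup x i * entry G i j * lookup x j

PosDef : Mat → Set
PosDef G = (x : Vec3) → x ≢ replicate 3 0ℤ → 0ℤ < Q G x

IsIsometry : Mat → Mat → Set
IsIsometry G M = ((transpose M · G) · M ≡ G) × Σ Mat (λ N → (M · N ≡ I₃) × (N · M ≡ I₃))

HasCard : {A : Set} → (A → Set) → ℕ → Set
HasCard {A} P n = Σ (List A) λ xs →
  (length xs ≡ n) × Unique xs × ((x : A) → (P x → x ∈ xs) × (x ∈ xs → P x))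

K₁ : ℕ → ℕ → Mat
K₁ a b = ((+ 2 * + a) ∷ (- + a) ∷ (- + a) ∷ [])
       ∷ ((- + a) ∷ (+ 2 * + a) ∷ 0ℤ ∷ [])
       ∷ ((- + a) ∷ 0ℤ ∷ + b ∷ [])
       ∷ []

K₂ : ℕ → ℕ → Mat
K₂ a b = ((+ 2 * + a) ∷ (- + a) ∷ 0ℤ ∷ [])
       ∷ ((- + a) ∷ (+ 2 * + a) ∷ 0ℤ ∷ [])
       ∷ (0ℤ ∷ 0ℤ ∷ + b ∷ [])
       ∷ []

module Submission where

-- Write K = a·H + b·E₃ with E₃ = e₃e₃ᵀ, where H is the Gram matrix of the hexagonal plane ⟨e₁, e₂⟩, joined to
-- e₃ by the entry −1 in the case of K₁. Let M be an isometry with columns cᵢ = (xᵢ, yᵢ, zᵢ). Comparing the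
-- last columns of Mᵀ K = K M⁻¹ shows a ∣ b·zᵢ, hence a ∣ zᵢ, for i = 1, 2. Completing the square in the norm
-- equation K(cᵢ, cᵢ) = 2a bounds zᵢ² by a constant times a, so zᵢ = 0 unless (a, b) is one of finitely many
-- pairs: for K₁ these are the excluded ones and (2, 2); for K₂ the pairing K(c₁, c₂) = −a rules them out.
-- So M fixes the plane, its last diagonal entry is ±1, it preserves H, and x² − xy + y² ≤ max(1, |x|) on
-- every column puts all entries in {−1, 0, 1}. Among the 3⁶·2 matrices of this shape, evaluation finds
-- exactly 12 preserving H₁ and 24 preserving H₂.

open import Defs
open import Data.Nat using (ℕ; _≤_)
open import Data.Nat.Coprimality using (Coprime)
open import Data.Product using (_×_)
open import Relation.Nullary using (¬_)
open import Relation.Binary.PropositionalEquality using (_≡_)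

open import Data.Empty using (⊥; ⊥-elim)
open import Data.Fin using (Fin; zero; suc)
open import Data.Fin.Patterns using (0F; 1F; 2F)
open import Data.List using (List; []; _∷_; map; cartesianProduct; filter; upTo)
open import Data.List.Membership.Propositional using (_∈_)
open import Data.List.Membership.Propositional.Properties
  using (∈-map⁺; ∈-cartesianProduct⁺; ∈-filter⁺; ∈-filter⁻; ∈-upTo⁺)
open import Data.List.Relation.Unary.All as All using (All; all?)
open import Data.List.Relation.Unary.AllPairs using (allPairs?)
open import Data.List.Relation.Unary.Any using (here; there)
open import Data.List.Relation.Unary.Unique.Propositional using (Unique)
open import Data.Product using (_,_; proj₁; proj₂)
open import Data.Sum using (_⊎_; inj₁; inj₂; [_,_]′)
open import Data.Unit using (tt)
import Data.Vec as Vec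
open import Data.Vec using (Vec; []; _∷_; lookup; tabulate; transpose; replicate; _⊛_)
open import Data.Vec.Properties using (lookup∘tabulate; tabulate∘lookup; tabulate-cong; lookup-⊛; lookup-replicate)
open import Function using (id)
open import Relation.Nullary using (Dec; yes; no; ¬?)
open import Relation.Nullary.Decidable using (toWitness; _×-dec_; _→-dec_)
open import Relation.Binary.PropositionalEquality
  using (_≢_; refl; sym; trans; cong; cong₂; subst; subst₂; module ≡-Reasoning)

module Arithmetic where
  open import Data.Nat
  open import Data.Nat.Properties
  open import Data.Nat.Divisibility using (_∣_; divides)
  open import Data.Nat.Tactic.RingSolver using (solve-∀)
  import Data.Product.Properties as Product
  open import Data.List.Membership.DecPropositional (Product.≡-dec _≟_ _≟_) using (_∈?_)

  exceptional-pairs : List (ℕ × ℕ)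
  exceptional-pairs = (1 , 1) ∷ (1 , 2) ∷ (2 , 2) ∷ (4 , 3) ∷ []

  small-discriminant : ∀ {a b} → 1 ≤ a → 2 * a < 3 * b → (3 * b ∸ 2 * a) * a ≤ 6 → (a , b) ∈ exceptional-pairs
  small-discriminant {a} {b} 1≤a 2a<3b Da≤6 =
    All.lookup (All.lookup table (∈-upTo⁺ (s≤s a≤6))) (∈-upTo⁺ (s≤s b≤6)) 1≤a 2a<3b Da≤6
    where
    D : ℕ
    D = 3 * b ∸ 2 * a
    a≤6 : a ≤ 6
    a≤6 = ≤-trans (m≤n*m a D {{>-nonZero (m<n⇒0<n∸m 2a<3b)}}) Da≤6
    b≤6 : b ≤ 6
    b≤6 = *-cancelˡ-≤ 3 (subst (_≤ 18) (m+[n∸m]≡n (<⇒≤ 2a<3b))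
            (+-mono-≤ (*-monoʳ-≤ 2 a≤6) (≤-trans (m≤m*n D a {{>-nonZero 1≤a}}) Da≤6)))
    table : All (λ a → All (λ b → 1 ≤ a → 2 * a < 3 * b → (3 * b ∸ 2 * a) * a ≤ 6 → (a , b) ∈ exceptional-pairs)
                           (upTo 7))
                (upTo 7)
    table = toWitness {a? = all? (λ a → all? (λ b →
              (1 ≤? a) →-dec ((2 * a <? 3 * b) →-dec
              (((3 * b ∸ 2 * a) * a ≤? 6) →-dec ((a , b) ∈? exceptional-pairs)))) (upTo 7)) (upTo 7)} tt

  divisor-square-bound : ∀ {a k c n} → 1 ≤ a → a ∣ k → c * (k * k) ≤ n * a → k ≡ 0 ⊎ c * a ≤ n
  divisor-square-bound _ (divides zero k≡0) _ = inj₁ k≡0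
  divisor-square-bound {a} {_} {c} {n} 1≤a (divides (suc t) refl) bound =
    inj₂ (≤-trans (m≤m*n (c * a) (suc t * suc t))
                  (*-cancelʳ-≤ _ n a {{>-nonZero 1≤a}} (subst (_≤ n * a) (regroup c a (suc t)) bound)))
    where
    regroup : ∀ c a t → c * ((t * a) * (t * a)) ≡ c * a * (t * t) * a
    regroup = solve-∀

  a[2p]+bk²≡2a⇒k≡0⊎p≡0 : ∀ {a b p k} → 1 ≤ b → a * (2 * p) + b * (k * k) ≡ 2 * a → k ≡ 0 ⊎ p ≡ 0
  a[2p]+bk²≡2a⇒k≡0⊎p≡0 {p = zero} _ _ = inj₂ refl
  a[2p]+bk²≡2a⇒k≡0⊎p≡0 {a} {b} {suc p} {k} 1≤b eq
    with m*n≡0⇒m≡0∨n≡0 b {k * k} (m+n≡0⇒n≡0 (a * (2 * p)) rest≡0)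
    where
    regroup : ∀ a p m → a * (2 * suc p) + m ≡ 2 * a + (a * (2 * p) + m)
    regroup = solve-∀
    rest≡0 : a * (2 * p) + b * (k * k) ≡ 0
    rest≡0 = +-cancelˡ-≡ (2 * a) _ 0 (trans (sym (regroup a p (b * (k * k)))) (trans eq (sym (+-identityʳ (2 * a)))))
  ... | inj₁ refl = ⊥-elim (<⇒≱ 1≤b z≤n)
  ... | inj₂ k²≡0 = inj₁ ([ id , id ]′ (m*n≡0⇒m≡0∨n≡0 k k²≡0))

  bk₁k₂≡a⇒bk₁²≢2a : ∀ {a b k₁ k₂} → 1 ≤ a → a ∣ k₂ → b * (k₁ * k₂) ≡ a → b * (k₁ * k₁) ≢ 2 * a
  bk₁k₂≡a⇒bk₁²≢2a {a} {b} {k₁} 1≤a (divides t refl) pair norm =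
    <⇒≱ (*-monoʳ-≤ 2 1≤a) (≤-reflexive (trans (sym norm) bk₁²≡1))
    where
    regroup : ∀ a b k t → b * (k * (t * a)) ≡ b * k * t * a
    regroup = solve-∀
    bk₁≡1 : b * k₁ ≡ 1
    bk₁≡1 = m*n≡1⇒m≡1 (b * k₁) t
              (*-cancelʳ-≡ _ 1 a {{>-nonZero 1≤a}} (trans (sym (regroup a b k₁ t)) (trans pair (sym (*-identityˡ a)))))
    bk₁²≡1 : b * (k₁ * k₁) ≡ 1
    bk₁²≡1 = trans (sym (*-assoc b k₁ k₁)) (cong₂ _*_ bk₁≡1 (m*n≡1⇒n≡1 b k₁ bk₁≡1))

  2ap+3Dk²≡18a⇒Dk²≤6a : ∀ {a p D k} → 2 * a * p + 3 * D * (k * k) ≡ 9 * (2 * a) → D * (k * k) ≤ 6 * a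
  2ap+3Dk²≡18a⇒Dk²≤6a {a} {p} {D} {k} eq =
    *-cancelˡ-≤ 3 (subst₂ _≤_ (*-assoc 3 D (k * k)) (regroup a) (subst (3 * D * (k * k) ≤_) eq (m≤n+m _ (2 * a * p))))
    where
    regroup : ∀ a → 9 * (2 * a) ≡ 3 * (6 * a)
    regroup = solve-∀

  3k≤4⇒k≤1 : ∀ {k} → 3 * k ≤ 4 → k ≤ 1
  3k≤4⇒k≤1 {zero}        _ = z≤n
  3k≤4⇒k≤1 {suc zero}    _ = s≤s z≤n
  3k≤4⇒k≤1 {suc (suc k)} h = ⊥-elim (<⇒≱ (m≤m+n 5 1) (≤-trans (*-monoʳ-≤ 3 (s≤s (s≤s (z≤n {k})))) h))

  3k²≤4⇒k≤1 : ∀ {k} → 3 * (k * k) ≤ 4 → k ≤ 1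
  3k²≤4⇒k≤1 {zero}      _ = z≤n
  3k²≤4⇒k≤1 {k@(suc _)} h = 3k≤4⇒k≤1 (≤-trans (*-monoʳ-≤ 3 (m≤m*n k k)) h)

  3k²≤4k⇒k≤1 : ∀ {k} → 3 * (k * k) ≤ 4 * k → k ≤ 1
  3k²≤4k⇒k≤1 {zero}      _ = z≤n
  3k²≤4k⇒k≤1 {k@(suc _)} h = 3k≤4⇒k≤1 (*-cancelʳ-≤ (3 * k) 4 k (subst (_≤ 4 * k) (sym (*-assoc 3 k k)) h))

  3k²≤0⇒k≡0 : ∀ {k} → 3 * (k * k) ≤ 0 → k ≡ 0
  3k²≤0⇒k≡0 {zero}  _ = refl
  3k²≤0⇒k≡0 {suc k} ()

open Arithmetic

import Data.Nat as ℕ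
import Data.Nat.Properties as ℕ
import Data.Nat.Divisibility as ℕ
open import Data.Nat.Divisibility using (divides)
open import Data.Nat.Coprimality using (coprime-divisor)
open import Data.Integer using (ℤ; NonZero; _⊖_; +_; -[1+_]; 0ℤ; 1ℤ; -1ℤ; _+_; _-_; _*_; -_; ∣_∣)
import Data.Integer as ℤ
import Data.Integer.Properties as ℤ
open import Data.Integer.Tactic.RingSolver using (solve-∀)
open ≡-Reasoning

trits : List ℤ
trits = -1ℤ ∷ 0ℤ ∷ 1ℤ ∷ []

signs : List ℤ
signs = -1ℤ ∷ 1ℤ ∷ []

∣x∣≤1⇒x∈trits : ∀ {x} → ∣ x ∣ ℕ.≤ 1 → x ∈ trits
∣x∣≤1⇒x∈trits {+ 0}                _ = there (here refl)
∣x∣≤1⇒x∈trits {+ 1}                _ = there (there (here refl))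
∣x∣≤1⇒x∈trits {+ ℕ.suc (ℕ.suc _)}  (ℕ.s≤s ())
∣x∣≤1⇒x∈trits { -[1+ 0 ]}          _ = here refl
∣x∣≤1⇒x∈trits { -[1+ ℕ.suc _ ]}    (ℕ.s≤s ())

unit⇒∈signs : ∀ {z n} → z * n ≡ 1ℤ → z ∈ signs
unit⇒∈signs {z} {n} zn≡1 with ℕ.m*n≡1⇒m≡1 ∣ z ∣ ∣ n ∣ (trans (sym (ℤ.abs-* z n)) (cong ∣_∣ zn≡1))
unit⇒∈signs {+ _}       _ | refl = there (here refl)
unit⇒∈signs { -[1+ _ ]} _ | refl = here refl

sign-squared : ∀ {ε} → ε ∈ signs → ε * ε ≡ 1ℤ
sign-squared (here refl)         = refl
sign-squared (there (here refl)) = refl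

∣sign∣≡1 : ∀ {ε} → ε ∈ signs → ∣ ε ∣ ≡ 1
∣sign∣≡1 (here refl)         = refl
∣sign∣≡1 (there (here refl)) = refl

square≡+∣∣² : ∀ z → z * z ≡ + (∣ z ∣ ℕ.* ∣ z ∣)
square≡+∣∣² (+ n)    = sym (ℤ.pos-* n n)
square≡+∣∣² -[1+ n ] = refl

sum-of-squares : ∀ u v → u * u + + 3 * (v * v) ≡ + (∣ u ∣ ℕ.* ∣ u ∣ ℕ.+ 3 ℕ.* (∣ v ∣ ℕ.* ∣ v ∣))
sum-of-squares u v =
  cong₂ _+_ (square≡+∣∣² u) (trans (cong (+ 3 *_) (square≡+∣∣² v)) (sym (ℤ.pos-* 3 (∣ v ∣ ℕ.* ∣ v ∣))))

pos-*³ : ∀ m n p → + m * + n * + p ≡ + (m ℕ.* n ℕ.* p)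
pos-*³ m n p = trans (cong (_* + p) (sym (ℤ.pos-* m n))) (sym (ℤ.pos-* (m ℕ.* n) p))

4p≡+m⇒4∣p∣≡m : ∀ {p m} → + 4 * p ≡ + m → 4 ℕ.* ∣ p ∣ ≡ m
4p≡+m⇒4∣p∣≡m {+ n}       eq = ℤ.+-injective (trans (ℤ.pos-* 4 n) eq)
4p≡+m⇒4∣p∣≡m { -[1+ _ ]} ()

4p≡+m⇒p≡+∣p∣ : ∀ {p m} → + 4 * p ≡ + m → p ≡ + ∣ p ∣
4p≡+m⇒p≡+∣p∣ {+ _}       _  = refl
4p≡+m⇒p≡+∣p∣ { -[1+ _ ]} ()

twice≡2⇒∣∣≤1 : ∀ {t} → + 2 * t ≡ + 2 → ∣ t ∣ ℕ.≤ 1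
twice≡2⇒∣∣≤1 {t} eq = ℕ.≤-reflexive (cong ∣_∣ (ℤ.*-cancelˡ-≡ (+ 2) t 1ℤ eq))

twice≡0⇒≡0 : ∀ {t} → + 2 * t ≡ 0ℤ → t ≡ 0ℤ
twice≡0⇒≡0 {t} eq = ℤ.*-cancelˡ-≡ (+ 2) t 0ℤ eq

coprime-divisor-abs : ∀ {a b z w} → Coprime a b → + b * z ≡ + a * w → a ℕ.∣ ∣ z ∣
coprime-divisor-abs {a} {b} {z} {w} cop eq = coprime-divisor cop (divides ∣ w ∣ (begin
  b ℕ.* ∣ z ∣   ≡⟨ ℤ.abs-* (+ b) z ⟨
  ∣ + b * z ∣   ≡⟨ cong ∣_∣ eq ⟩
  ∣ + a * w ∣   ≡⟨ ℤ.abs-* (+ a) w ⟩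
  a ℕ.* ∣ w ∣   ≡⟨ ℕ.*-comm a ∣ w ∣ ⟩
  ∣ w ∣ ℕ.* a   ∎))

eisNorm : ℤ → ℤ → ℤ
eisNorm x y = x * x - x * y + y * y

4eisNorm≡ˡ : ∀ x y → + 4 * eisNorm x y ≡ (+ 2 * x - y) * (+ 2 * x - y) + + 3 * (y * y)
4eisNorm≡ˡ = identity
  where
  identity : ∀ x y → + 4 * (x * x - x * y + y * y) ≡ (+ 2 * x - y) * (+ 2 * x - y) + + 3 * (y * y)
  identity = solve-∀

4eisNorm≡ʳ : ∀ x y → + 4 * eisNorm x y ≡ (+ 2 * y - x) * (+ 2 * y - x) + + 3 * (x * x)
4eisNorm≡ʳ = identity
  where
  identity : ∀ x y → + 4 * (x * x - x * y + y * y) ≡ (+ 2 * y - x) * (+ 2 * y - x) + + 3 * (x * x)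
  identity = solve-∀

eisNorm≡+∣∣ : ∀ x y → eisNorm x y ≡ + ∣ eisNorm x y ∣
eisNorm≡+∣∣ x y = 4p≡+m⇒p≡+∣p∣ (trans (4eisNorm≡ˡ x y) (sum-of-squares (+ 2 * x - y) y))

3∣y∣²≤4eisNorm : ∀ x y → 3 ℕ.* (∣ y ∣ ℕ.* ∣ y ∣) ℕ.≤ 4 ℕ.* ∣ eisNorm x y ∣
3∣y∣²≤4eisNorm x y = subst (3 ℕ.* (∣ y ∣ ℕ.* ∣ y ∣) ℕ.≤_)
  (sym (4p≡+m⇒4∣p∣≡m (trans (4eisNorm≡ˡ x y) (sum-of-squares u y)))) (ℕ.m≤n+m _ (∣ u ∣ ℕ.* ∣ u ∣))
  where
  u : ℤ
  u = + 2 * x - y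

3∣x∣²≤4eisNorm : ∀ x y → 3 ℕ.* (∣ x ∣ ℕ.* ∣ x ∣) ℕ.≤ 4 ℕ.* ∣ eisNorm x y ∣
3∣x∣²≤4eisNorm x y = subst (3 ℕ.* (∣ x ∣ ℕ.* ∣ x ∣) ℕ.≤_)
  (sym (4p≡+m⇒4∣p∣≡m (trans (4eisNorm≡ʳ x y) (sum-of-squares u x)))) (ℕ.m≤n+m _ (∣ u ∣ ℕ.* ∣ u ∣))
  where
  u : ℤ
  u = + 2 * y - x

eisNorm≤1⇒trits : ∀ {x y} → ∣ eisNorm x y ∣ ℕ.≤ 1 → x ∈ trits × y ∈ trits
eisNorm≤1⇒trits {x} {y} h =
  ∣x∣≤1⇒x∈trits (3k²≤4⇒k≤1 (ℕ.≤-trans (3∣x∣²≤4eisNorm x y) (ℕ.*-monoʳ-≤ 4 h))) ,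
  ∣x∣≤1⇒x∈trits (3k²≤4⇒k≤1 (ℕ.≤-trans (3∣y∣²≤4eisNorm x y) (ℕ.*-monoʳ-≤ 4 h)))

eisNorm≤∣x∣⇒trits : ∀ {x y} → ∣ eisNorm x y ∣ ℕ.≤ ∣ x ∣ → x ∈ trits × y ∈ trits
eisNorm≤∣x∣⇒trits {x} {y} h =
  eisNorm≤1⇒trits (ℕ.≤-trans h (3k²≤4k⇒k≤1 (ℕ.≤-trans (3∣x∣²≤4eisNorm x y) (ℕ.*-monoʳ-≤ 4 h))))

eisNorm≡0⇒≡0 : ∀ {x y} → eisNorm x y ≡ 0ℤ → x ≡ 0ℤ × y ≡ 0ℤ
eisNorm≡0⇒≡0 {x} {y} h = vanishes x (3∣x∣²≤4eisNorm x y) , vanishes y (3∣y∣²≤4eisNorm x y)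
  where
  vanishes : ∀ z → 3 ℕ.* (∣ z ∣ ℕ.* ∣ z ∣) ℕ.≤ 4 ℕ.* ∣ eisNorm x y ∣ → z ≡ 0ℤ
  vanishes z bound =
    ℤ.∣i∣≡0⇒i≡0 (3k²≤0⇒k≡0 (subst (λ n → 3 ℕ.* (∣ z ∣ ℕ.* ∣ z ∣) ℕ.≤ 4 ℕ.* ∣ n ∣) h bound))

-- 3 × 3 matrices and bilinear forms

pattern vec3 x y z = x ∷ y ∷ z ∷ []
pattern mat x₁ x₂ x₃ y₁ y₂ y₃ z₁ z₂ z₃ = vec3 (vec3 x₁ x₂ x₃) (vec3 y₁ y₂ y₃) (vec3 z₁ z₂ z₃)

sum3-cong : ∀ {f g : Fin 3 → ℤ} → (∀ k → f k ≡ g k) → sum3 f ≡ sum3 g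
sum3-cong h = cong₂ _+_ (cong₂ _+_ (h 0F) (h 1F)) (h 2F)

sum3-+ : ∀ (f g : Fin 3 → ℤ) → sum3 (λ k → f k + g k) ≡ sum3 f + sum3 g
sum3-+ f g = identity (f 0F) (f 1F) (f 2F) (g 0F) (g 1F) (g 2F)
  where
  identity : ∀ p q r s t u → (p + s) + (q + t) + (r + u) ≡ (p + q + r) + (s + t + u)
  identity = solve-∀

*-sum3 : ∀ c (f : Fin 3 → ℤ) → c * sum3 f ≡ sum3 (λ k → c * f k)
*-sum3 c f = identity c (f 0F) (f 1F) (f 2F)
  where
  identity : ∀ c p q r → c * (p + q + r) ≡ c * p + c * q + c * r
  identity = solve-∀

sum3-* : ∀ (f : Fin 3 → ℤ) c → sum3 f * c ≡ sum3 (λ k → f k * c)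
sum3-* f c = identity c (f 0F) (f 1F) (f 2F)
  where
  identity : ∀ c p q r → (p + q + r) * c ≡ p * c + q * c + r * c
  identity = solve-∀

sum3-swap : ∀ (f : Fin 3 → Fin 3 → ℤ) → sum3 (λ k → sum3 (f k)) ≡ sum3 (λ l → sum3 (λ k → f k l))
sum3-swap f = identity (f 0F 0F) (f 0F 1F) (f 0F 2F) (f 1F 0F) (f 1F 1F) (f 1F 2F) (f 2F 0F) (f 2F 1F) (f 2F 2F)
  where
  identity : ∀ a b c d e g h i j →
             (a + b + c) + (d + e + g) + (h + i + j) ≡ (a + d + h) + (b + e + i) + (c + g + j)
  identity = solve-∀

entry-· : ∀ M N i j → entry (M · N) i j ≡ sum3 (λ k → entry M i k * entry N k j)
entry-· M N i j =
  trans (cong (λ row → lookup row j) (lookup∘tabulate (λ i → tabulate (product i)) i)) (lookup∘tabulate (product i) j)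
  where
  product : Fin 3 → Fin 3 → ℤ
  product i j = sum3 λ k → entry M i k * entry N k j

lookup-transpose : ∀ {A : Set} {m n} (M : Vec (Vec A n) m) i j →
                   lookup (lookup (transpose M) i) j ≡ lookup (lookup M j) i
lookup-transpose {n = n} (row ∷ M) i j = trans (cong (λ v → lookup v j) transpose-row) (step j)
  where
  transpose-row : lookup (transpose (row ∷ M)) i ≡ lookup row i ∷ lookup (transpose M) i
  transpose-row = begin
    lookup ((replicate n Vec._∷_ ⊛ row) ⊛ transpose M) i
      ≡⟨ lookup-⊛ i (replicate n Vec._∷_ ⊛ row) (transpose M) ⟩
    lookup (replicate n Vec._∷_ ⊛ row) i (lookup (transpose M) i)
      ≡⟨ cong (λ f → f (lookup (transpose M) i)) (lookup-⊛ i (replicate n Vec._∷_) row) ⟩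
    lookup (replicate n Vec._∷_) i (lookup row i) (lookup (transpose M) i)
      ≡⟨ cong (λ f → f (lookup row i) (lookup (transpose M) i)) (lookup-replicate i Vec._∷_) ⟩
    lookup row i ∷ lookup (transpose M) i
      ∎
  step : ∀ j → lookup (lookup row i ∷ lookup (transpose M) i) j ≡ lookup (lookup (row ∷ M) j) i
  step zero    = refl
  step (suc j) = lookup-transpose M i j

matrix-ext : ∀ {M N : Mat} → (∀ i j → entry M i j ≡ entry N i j) → M ≡ N
matrix-ext {M} {N} h = begin
  M                                             ≡⟨ rows M ⟨
  tabulate (λ i → tabulate (λ j → entry M i j)) ≡⟨ tabulate-cong (λ i → tabulate-cong (h i)) ⟩
  tabulate (λ i → tabulate (λ j → entry N i j)) ≡⟨ rows N ⟩
  N                                             ∎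
  where
  rows : ∀ X → tabulate (λ i → tabulate (λ j → entry X i j)) ≡ X
  rows X = trans (tabulate-cong (λ i → tabulate∘lookup (lookup X i))) (tabulate∘lookup X)

·-assoc : ∀ A B C → (A · B) · C ≡ A · (B · C)
·-assoc A B C = matrix-ext λ i j → begin
  entry ((A · B) · C) i j
    ≡⟨ entry-· (A · B) C i j ⟩
  sum3 (λ k → entry (A · B) i k * entry C k j)
    ≡⟨ sum3-cong (λ k → cong (_* entry C k j) (entry-· A B i k)) ⟩
  sum3 (λ k → sum3 (λ l → entry A i l * entry B l k) * entry C k j)
    ≡⟨ sum3-cong (λ k → sum3-* (λ l → entry A i l * entry B l k) (entry C k j)) ⟩
  sum3 (λ k → sum3 (λ l → entry A i l * entry B l k * entry C k j))
    ≡⟨ sum3-swap (λ k l → entry A i l * entry B l k * entry C k j) ⟩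
  sum3 (λ l → sum3 (λ k → entry A i l * entry B l k * entry C k j))
    ≡⟨ sum3-cong (λ l → sum3-cong (λ k → ℤ.*-assoc (entry A i l) (entry B l k) (entry C k j))) ⟩
  sum3 (λ l → sum3 (λ k → entry A i l * (entry B l k * entry C k j)))
    ≡⟨ sum3-cong (λ l → *-sum3 (entry A i l) (λ k → entry B l k * entry C k j)) ⟨
  sum3 (λ l → entry A i l * sum3 (λ k → entry B l k * entry C k j))
    ≡⟨ sum3-cong (λ l → cong (entry A i l *_) (entry-· B C l j)) ⟨
  sum3 (λ l → entry A i l * entry (B · C) l j)
    ≡⟨ entry-· A (B · C) i j ⟨
  entry (A · (B · C)) i j
    ∎

·-identityʳ : ∀ M → M · I₃ ≡ M
·-identityʳ M = matrix-ext λ i j → trans (entry-· M I₃ i j) (column-of-I₃ i j)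
  where
  column-of-I₃ : ∀ i j → sum3 (λ k → entry M i k * entry I₃ k j) ≡ entry M i j
  column-of-I₃ i 0F = first (entry M i 0F) (entry M i 1F) (entry M i 2F)
    where first : ∀ p q r → p * 1ℤ + q * 0ℤ + r * 0ℤ ≡ p
          first = solve-∀
  column-of-I₃ i 1F = second (entry M i 0F) (entry M i 1F) (entry M i 2F)
    where second : ∀ p q r → p * 0ℤ + q * 1ℤ + r * 0ℤ ≡ q
          second = solve-∀
  column-of-I₃ i 2F = third (entry M i 0F) (entry M i 1F) (entry M i 2F)
    where third : ∀ p q r → p * 0ℤ + q * 0ℤ + r * 1ℤ ≡ r
          third = solve-∀

infix 30 _^_
_^_ : Mat → ℕ → Mat
M ^ ℕ.zero  = I₃
M ^ ℕ.suc n = M · M ^ n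

_≟ₘ_ : (M N : Mat) → Dec (M ≡ N)
_≟ₘ_ = Data.Vec.Properties.≡-dec (Data.Vec.Properties.≡-dec ℤ._≟_)

column : Mat → Fin 3 → Vec3
column M = lookup (transpose M)

β : Mat → Vec3 → Vec3 → ℤ
β G u v = sum3 λ k → sum3 (λ l → lookup u l * entry G l k) * lookup v k

gram-entry : ∀ G M i j → entry ((transpose M · G) · M) i j ≡ β G (column M i) (column M j)
gram-entry G M i j = begin
  entry ((transpose M · G) · M) i j
    ≡⟨ entry-· (transpose M · G) M i j ⟩
  sum3 (λ k → entry (transpose M · G) i k * entry M k j)
    ≡⟨ sum3-cong (λ k → cong₂ _*_ (entry-· (transpose M) G i k) (sym (lookup-transpose M j k))) ⟩
  β G (column M i) (column M j)
    ∎

record IsCombination (G : Mat) (c : ℤ) (X : Mat) (d : ℤ) (Y : Mat) : Set where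
  constructor combination
  field
    entries : ∀ i j → entry G i j ≡ c * entry X i j + d * entry Y i j
open IsCombination

β-linear : ∀ {G c X d Y} → IsCombination G c X d Y → ∀ u v → β G u v ≡ c * β X u v + d * β Y u v
β-linear {G} {c} {X} {d} {Y} G≡ u v = begin
  sum3 (λ k → ρ G k * lookup v k)
    ≡⟨ sum3-cong (λ k → cong (_* lookup v k) (ρ-linear k)) ⟩
  sum3 (λ k → (c * ρ X k + d * ρ Y k) * lookup v k)
    ≡⟨ sum3-cong (λ k → distribʳ c d (ρ X k) (ρ Y k) (lookup v k)) ⟩
  sum3 (λ k → c * (ρ X k * lookup v k) + d * (ρ Y k * lookup v k))
    ≡⟨ sum3-+ (λ k → c * (ρ X k * lookup v k)) (λ k → d * (ρ Y k * lookup v k)) ⟩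
  sum3 (λ k → c * (ρ X k * lookup v k)) + sum3 (λ k → d * (ρ Y k * lookup v k))
    ≡⟨ cong₂ _+_ (*-sum3 c (λ k → ρ X k * lookup v k)) (*-sum3 d (λ k → ρ Y k * lookup v k)) ⟨
  c * β X u v + d * β Y u v
    ∎
  where
  ρ : Mat → Fin 3 → ℤ
  ρ H k = sum3 λ l → lookup u l * entry H l k
  distribˡ : ∀ c d x y u → u * (c * x + d * y) ≡ c * (u * x) + d * (u * y)
  distribˡ = solve-∀
  distribʳ : ∀ c d x y v → (c * x + d * y) * v ≡ c * (x * v) + d * (y * v)
  distribʳ = solve-∀
  ρ-linear : ∀ k → ρ G k ≡ c * ρ X k + d * ρ Y k
  ρ-linear k = begin
    sum3 (λ l → lookup u l * entry G l k)
      ≡⟨ sum3-cong (λ l → trans (cong (lookup u l *_) (entries G≡ l k))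
                                (distribˡ c d (entry X l k) (entry Y l k) (lookup u l))) ⟩
    sum3 (λ l → c * (lookup u l * entry X l k) + d * (lookup u l * entry Y l k))
      ≡⟨ sum3-+ (λ l → c * (lookup u l * entry X l k)) (λ l → d * (lookup u l * entry Y l k)) ⟩
    sum3 (λ l → c * (lookup u l * entry X l k)) + sum3 (λ l → d * (lookup u l * entry Y l k))
      ≡⟨ cong₂ _+_ (*-sum3 c (λ l → lookup u l * entry X l k)) (*-sum3 d (λ l → lookup u l * entry Y l k)) ⟨
    c * ρ X k + d * ρ Y k
      ∎

Preserves : Mat → Mat → Set
Preserves M G = (transpose M · G) · M ≡ G

preserved-gram : ∀ {G} M → Preserves M G → ∀ i j → β G (column M i) (column M j) ≡ entry G i j
preserved-gram {G} M pres i j = trans (sym (gram-entry G M i j)) (cong (λ P → entry P i j) pres)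

preserved-gram-combination : ∀ {G c X d Y} → IsCombination G c X d Y → ∀ M → Preserves M G → ∀ i j →
                             c * β X (column M i) (column M j) + d * β Y (column M i) (column M j) ≡ entry G i j
preserved-gram-combination G≡ M pres i j = trans (sym (β-linear G≡ (column M i) (column M j))) (preserved-gram M pres i j)

congruence-combination : ∀ {G c X d Y} → IsCombination G c X d Y → ∀ M →
                         IsCombination ((transpose M · G) · M) c ((transpose M · X) · M) d ((transpose M · Y) · M)
congruence-combination {G} {c} {X} {d} {Y} G≡ M = combination λ i j → begin
  entry ((transpose M · G) · M) i j
    ≡⟨ gram-entry G M i j ⟩
  β G (column M i) (column M j)
    ≡⟨ β-linear G≡ (column M i) (column M j) ⟩
  c * β X (column M i) (column M j) + d * β Y (column M i) (column M j)
    ≡⟨ cong₂ (λ p q → c * p + d * q) (gram-entry X M i j) (gram-entry Y M i j) ⟨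
  c * entry ((transpose M · X) · M) i j + d * entry ((transpose M · Y) · M) i j
    ∎

preserves-combination : ∀ {G c X d Y M} → IsCombination G c X d Y → Preserves M X → Preserves M Y → Preserves M G
preserves-combination {G} {c} {X} {d} {Y} {M} G≡ pX pY = matrix-ext λ i j → begin
  entry ((transpose M · G) · M) i j
    ≡⟨ entries (congruence-combination G≡ M) i j ⟩
  c * entry ((transpose M · X) · M) i j + d * entry ((transpose M · Y) · M) i j
    ≡⟨ cong₂ (λ P Q → c * entry P i j + d * entry Q i j) pX pY ⟩
  c * entry X i j + d * entry Y i j
    ≡⟨ entries G≡ i j ⟨
  entry G i j
    ∎

preserves-component : ∀ {G c X d Y M} .{{_ : NonZero c}} → IsCombination G c X d Y →
                      Preserves M G → Preserves M Y → Preserves M X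
preserves-component {G} {c} {X} {d} {Y} {M} G≡ pG pY = matrix-ext λ i j →
  ℤ.*-cancelˡ-≡ c _ _ (+-cancelʳ (d * entry Y i j) (begin
    c * entry ((transpose M · X) · M) i j + d * entry Y i j
      ≡⟨ cong (λ Q → c * entry ((transpose M · X) · M) i j + d * entry Q i j) pY ⟨
    c * entry ((transpose M · X) · M) i j + d * entry ((transpose M · Y) · M) i j
      ≡⟨ entries (congruence-combination G≡ M) i j ⟨
    entry ((transpose M · G) · M) i j
      ≡⟨ cong (λ P → entry P i j) pG ⟩
    entry G i j
      ≡⟨ entries G≡ i j ⟩
    c * entry X i j + d * entry Y i j
      ∎))
  where
  +-cancelʳ : ∀ {p q} r → p + r ≡ q + r → p ≡ q
  +-cancelʳ {p} {q} r eq = trans (sym (cancel p r)) (trans (cong (_- r) eq) (cancel q r))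
    where
    cancel : ∀ p r → p + r - r ≡ p
    cancel = solve-∀

transpose-inverse : ∀ {G M N} → Preserves M G → M · N ≡ I₃ → transpose M · G ≡ G · N
transpose-inverse {G} {M} {N} pres MN≡I = begin
  transpose M · G               ≡⟨ ·-identityʳ (transpose M · G) ⟨
  (transpose M · G) · I₃        ≡⟨ cong ((transpose M · G) ·_) MN≡I ⟨
  (transpose M · G) · (M · N)   ≡⟨ ·-assoc (transpose M · G) M N ⟨
  ((transpose M · G) · M) · N   ≡⟨ cong (_· N) pres ⟩
  G · N                         ∎

-- The lattices K₁ and K₂

H₁ : Mat
H₁ = mat (+ 2) -1ℤ   -1ℤ
         -1ℤ   (+ 2) 0ℤ
         -1ℤ   0ℤ    0ℤ

H₂ : Mat
H₂ = mat (+ 2) -1ℤ   0ℤ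
         -1ℤ   (+ 2) 0ℤ
         0ℤ    0ℤ    0ℤ

E₃ : Mat
E₃ = mat 0ℤ 0ℤ 0ℤ
         0ℤ 0ℤ 0ℤ
         0ℤ 0ℤ 1ℤ

module _ (a b : ℕ) where
  private
    double : + 2 * + a ≡ + a * + 2 + + b * 0ℤ
    double = identity (+ a) (+ b)
      where identity : ∀ A B → + 2 * A ≡ A * + 2 + B * 0ℤ
            identity = solve-∀
    negate : - + a ≡ + a * -1ℤ + + b * 0ℤ
    negate = identity (+ a) (+ b)
      where identity : ∀ A B → - A ≡ A * -1ℤ + B * 0ℤ
            identity = solve-∀
    vanish : 0ℤ ≡ + a * 0ℤ + + b * 0ℤ
    vanish = identity (+ a) (+ b)
      where identity : ∀ A B → 0ℤ ≡ A * 0ℤ + B * 0ℤ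
            identity = solve-∀
    last : + b ≡ + a * 0ℤ + + b * 1ℤ
    last = identity (+ a) (+ b)
      where identity : ∀ A B → B ≡ A * 0ℤ + B * 1ℤ
            identity = solve-∀

  K₁-combination : IsCombination (K₁ a b) (+ a) H₁ (+ b) E₃
  K₁-combination = combination K₁-entries
    where
    K₁-entries : ∀ i j → entry (K₁ a b) i j ≡ + a * entry H₁ i j + + b * entry E₃ i j
    K₁-entries 0F 0F = double
    K₁-entries 0F 1F = negate
    K₁-entries 0F 2F = negate
    K₁-entries 1F 0F = negate
    K₁-entries 1F 1F = double
    K₁-entries 1F 2F = vanish
    K₁-entries 2F 0F = negate
    K₁-entries 2F 1F = vanish
    K₁-entries 2F 2F = last

  K₂-combination : IsCombination (K₂ a b) (+ a) H₂ (+ b) E₃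
  K₂-combination = combination K₂-entries
    where
    K₂-entries : ∀ i j → entry (K₂ a b) i j ≡ + a * entry H₂ i j + + b * entry E₃ i j
    K₂-entries 0F 0F = double
    K₂-entries 0F 1F = negate
    K₂-entries 0F 2F = vanish
    K₂-entries 1F 0F = negate
    K₂-entries 1F 1F = double
    K₂-entries 1F 2F = vanish
    K₂-entries 2F 0F = vanish
    K₂-entries 2F 1F = vanish
    K₂-entries 2F 2F = last

H₁-norm : ∀ x y z → β H₁ (vec3 x y z) (vec3 x y z) ≡ + 2 * (eisNorm x y - x * z)
H₁-norm = identity
  where
  identity : ∀ x y z → (x * + 2 + y * -1ℤ + z * -1ℤ) * x + (x * -1ℤ + y * + 2 + z * 0ℤ) * y
                       + (x * -1ℤ + y * 0ℤ + z * 0ℤ) * z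
                       ≡ + 2 * (x * x - x * y + y * y - x * z)
  identity = solve-∀

H₁-plane-norm : ∀ x y → β H₁ (vec3 x y 0ℤ) (vec3 x y 0ℤ) ≡ + 2 * eisNorm x y
H₁-plane-norm x y = trans (H₁-norm x y 0ℤ) (cong (+ 2 *_) (drop (eisNorm x y) x))
  where
  drop : ∀ t x → t - x * 0ℤ ≡ t
  drop = solve-∀

H₂-norm : ∀ x y z → β H₂ (vec3 x y z) (vec3 x y z) ≡ + 2 * eisNorm x y
H₂-norm = identity
  where
  identity : ∀ x y z → (x * + 2 + y * -1ℤ + z * 0ℤ) * x + (x * -1ℤ + y * + 2 + z * 0ℤ) * y
                       + (x * 0ℤ + y * 0ℤ + z * 0ℤ) * z
                       ≡ + 2 * (x * x - x * y + y * y)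
  identity = solve-∀

H₂-axis : ∀ z v → β H₂ (vec3 0ℤ 0ℤ z) v ≡ 0ℤ
H₂-axis z (vec3 x′ y′ z′) = identity z x′ y′ z′
  where
  identity : ∀ z x′ y′ z′ → (0ℤ * + 2 + 0ℤ * -1ℤ + z * 0ℤ) * x′ + (0ℤ * -1ℤ + 0ℤ * + 2 + z * 0ℤ) * y′
                            + (0ℤ * 0ℤ + 0ℤ * 0ℤ + z * 0ℤ) * z′ ≡ 0ℤ
  identity = solve-∀

E₃-form : ∀ u v → β E₃ u v ≡ lookup u 2F * lookup v 2F
E₃-form (vec3 x y z) (vec3 x′ y′ z′) = identity x y z x′ y′ z′
  where
  identity : ∀ x y z x′ y′ z′ → (x * 0ℤ + y * 0ℤ + z * 0ℤ) * x′ + (x * 0ℤ + y * 0ℤ + z * 0ℤ) * y′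
                                + (x * 0ℤ + y * 0ℤ + z * 1ℤ) * z′ ≡ z * z′
  identity = solve-∀

lattice-form : ℕ → ℕ → Mat → Vec3 → Vec3 → ℤ
lattice-form a b X u v = + a * β X u v + + b * β E₃ u v

bottom-row-preserves-E₃ : ∀ x₁ x₂ x₃ y₁ y₂ y₃ {ε} → ε ∈ signs →
                          Preserves (mat x₁ x₂ x₃ y₁ y₂ y₃ 0ℤ 0ℤ ε) E₃
bottom-row-preserves-E₃ x₁ x₂ x₃ y₁ y₂ y₃ {ε} ε∈signs = matrix-ext λ i j →
  trans (gram-entry E₃ M i j) (trans (E₃-form (column M i) (column M j)) (bottom-products i j))
  where
  M : Mat
  M = mat x₁ x₂ x₃ y₁ y₂ y₃ 0ℤ 0ℤ ε
  bottom-products : ∀ i j → lookup (column M i) 2F * lookup (column M j) 2F ≡ entry E₃ i j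
  bottom-products 0F 0F = refl
  bottom-products 0F 1F = refl
  bottom-products 0F 2F = refl
  bottom-products 1F 0F = refl
  bottom-products 1F 1F = refl
  bottom-products 1F 2F = refl
  bottom-products 2F 0F = ℤ.*-zeroʳ ε
  bottom-products 2F 1F = ℤ.*-zeroʳ ε
  bottom-products 2F 2F = sign-squared ε∈signs

posdef⇒2a<3b : ∀ {a b} → PosDef (K₁ a b) → 2 ℕ.* a ℕ.< 3 ℕ.* b
posdef⇒2a<3b {a} {b} pd =
  ℕ.*-cancelˡ-< 3 (2 ℕ.* a) (3 ℕ.* b) (⊖-positive (subst (0ℤ ℤ.<_) value (pd (vec3 (+ 2) (+ 1) (+ 3)) (λ ()))))
  where
  value : Q (K₁ a b) (vec3 (+ 2) (+ 1) (+ 3)) ≡ (3 ℕ.* (3 ℕ.* b)) ⊖ (3 ℕ.* (2 ℕ.* a))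
  value = begin
    Q (K₁ a b) (vec3 (+ 2) (+ 1) (+ 3))       ≡⟨ identity (+ a) (+ b) ⟩
    + 9 * + b - + 6 * + a                     ≡⟨ cong₂ _-_ (ℤ.pos-* 9 b) (ℤ.pos-* 6 a) ⟨
    + (9 ℕ.* b) - + (6 ℕ.* a)                 ≡⟨ ℤ.m-n≡m⊖n (9 ℕ.* b) (6 ℕ.* a) ⟩
    (9 ℕ.* b) ⊖ (6 ℕ.* a)                     ≡⟨ cong₂ _⊖_ (ℕ.*-assoc 3 3 b) (ℕ.*-assoc 3 2 a) ⟩
    (3 ℕ.* (3 ℕ.* b)) ⊖ (3 ℕ.* (2 ℕ.* a))     ∎
    where
    identity : ∀ A B → + 2 * (+ 2 * A) * + 2 + + 2 * - A * + 1 + + 2 * - A * + 3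
                       + (+ 1 * - A * + 2 + + 1 * (+ 2 * A) * + 1 + + 1 * 0ℤ * + 3)
                       + (+ 3 * - A * + 2 + + 3 * 0ℤ * + 1 + + 3 * B * + 3)
                       ≡ + 9 * B - + 6 * A
    identity = solve-∀
  ⊖-positive : ∀ {m n} → 0ℤ ℤ.< m ⊖ n → n ℕ.< m
  ⊖-positive {m} {n} pos with n ℕ.<? m
  ... | yes n<m = n<m
  ... | no n≮m  = ⊥-elim (ℤ.<⇒≱ pos (subst (ℤ._≤ 0ℤ) (sym (ℤ.⊖-≤ (ℕ.≮⇒≥ n≮m))) ℤ.neg-≤-pos))

-- The plane ⟨e₁, e₂⟩ is invariant

-- Rows 1 and 2 of K are multiples of a, so comparing last columns of Mᵀ K = K N gives a ∣ b·zᵢ.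
K₁-third-row-divisible : ∀ {a b M N} → Coprime a b → Preserves M (K₁ a b) → M · N ≡ I₃ →
                         a ℕ.∣ ∣ entry M 2F 0F ∣ × a ℕ.∣ ∣ entry M 2F 1F ∣
K₁-third-row-divisible {a} {b} {M@(mat x₁ x₂ _ y₁ y₂ _ z₁ z₂ _)} {N@(mat _ _ n₁ _ _ n₂ _ _ n₃)} cop pres MN =
  coprime-divisor-abs cop (first-row (+ a) (+ b) x₁ y₁ z₁ n₁ n₂ n₃ (cong (λ P → entry P 0F 2F) dual)) ,
  coprime-divisor-abs cop (second-row (+ a) (+ b) x₂ y₂ z₂ n₁ n₂ n₃ (cong (λ P → entry P 1F 2F) dual))
  where
  dual : transpose M · K₁ a b ≡ K₁ a b · N
  dual = transpose-inverse {K₁ a b} {M} {N} pres MN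
  isolate : ∀ A B x y z → B * z ≡ x * - A + y * 0ℤ + z * B + A * x
  isolate = solve-∀
  first-row : ∀ A B x y z n₁ n₂ n₃ → x * - A + y * 0ℤ + z * B ≡ + 2 * A * n₁ + - A * n₂ + - A * n₃ →
              B * z ≡ A * (x + + 2 * n₁ - n₂ - n₃)
  first-row A B x y z n₁ n₂ n₃ eq = trans (isolate A B x y z) (trans (cong (_+ A * x) eq) (factor A x n₁ n₂ n₃))
    where
    factor : ∀ A x n₁ n₂ n₃ → + 2 * A * n₁ + - A * n₂ + - A * n₃ + A * x ≡ A * (x + + 2 * n₁ - n₂ - n₃)
    factor = solve-∀
  second-row : ∀ A B x y z n₁ n₂ n₃ → x * - A + y * 0ℤ + z * B ≡ - A * n₁ + + 2 * A * n₂ + 0ℤ * n₃ →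
               B * z ≡ A * (x - n₁ + + 2 * n₂)
  second-row A B x y z n₁ n₂ n₃ eq = trans (isolate A B x y z) (trans (cong (_+ A * x) eq) (factor A x n₁ n₂ n₃))
    where
    factor : ∀ A x n₁ n₂ n₃ → - A * n₁ + + 2 * A * n₂ + 0ℤ * n₃ + A * x ≡ A * (x - n₁ + + 2 * n₂)
    factor = solve-∀

K₂-third-row-divisible : ∀ {a b M N} → Coprime a b → Preserves M (K₂ a b) → M · N ≡ I₃ →
                         a ℕ.∣ ∣ entry M 2F 0F ∣ × a ℕ.∣ ∣ entry M 2F 1F ∣
K₂-third-row-divisible {a} {b} {M@(mat x₁ x₂ _ y₁ y₂ _ z₁ z₂ _)} {N@(mat _ _ n₁ _ _ n₂ _ _ n₃)} cop pres MN =
  coprime-divisor-abs cop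
    (trans (isolate (+ b) x₁ y₁ z₁) (trans (cong (λ P → entry P 0F 2F) dual) (first-row (+ a) n₁ n₂ n₃))) ,
  coprime-divisor-abs cop
    (trans (isolate (+ b) x₂ y₂ z₂) (trans (cong (λ P → entry P 1F 2F) dual) (second-row (+ a) n₁ n₂ n₃)))
  where
  dual : transpose M · K₂ a b ≡ K₂ a b · N
  dual = transpose-inverse {K₂ a b} {M} {N} pres MN
  isolate : ∀ B x y z → B * z ≡ x * 0ℤ + y * 0ℤ + z * B
  isolate = solve-∀
  first-row : ∀ A n₁ n₂ n₃ → + 2 * A * n₁ + - A * n₂ + 0ℤ * n₃ ≡ A * (+ 2 * n₁ - n₂)
  first-row = solve-∀
  second-row : ∀ A n₁ n₂ n₃ → - A * n₁ + + 2 * A * n₂ + 0ℤ * n₃ ≡ A * (+ 2 * n₂ - n₁)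
  second-row = solve-∀

-- Completing the square: 9·K₁(c, c) = 2a·eisNorm (3x − 2z) (3y − z) + 3(3b − 2a)·z² for c = (x, y, z).
K₁-norm-in-ℕ : ∀ {a b} x y z → 2 ℕ.* a ℕ.< 3 ℕ.* b →
               lattice-form a b H₁ (vec3 x y z) (vec3 x y z) ≡ + 2 * + a →
               2 ℕ.* a ℕ.* ∣ eisNorm (+ 3 * x - + 2 * z) (+ 3 * y - z) ∣ ℕ.+ 3 ℕ.* (3 ℕ.* b ℕ.∸ 2 ℕ.* a) ℕ.* (∣ z ∣ ℕ.* ∣ z ∣)
               ≡ 9 ℕ.* (2 ℕ.* a)
K₁-norm-in-ℕ {a} {b} x y z 2a<3b norm = ℤ.+-injective (begin
  + (2 ℕ.* a ℕ.* ∣ P′ ∣ ℕ.+ 3 ℕ.* D ℕ.* (∣ z ∣ ℕ.* ∣ z ∣))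
    ≡⟨ cong₂ _+_ (pos-*³ 2 a ∣ P′ ∣) (pos-*³ 3 D (∣ z ∣ ℕ.* ∣ z ∣)) ⟨
  + 2 * + a * + ∣ P′ ∣ + + 3 * + D * + (∣ z ∣ ℕ.* ∣ z ∣)
    ≡⟨ cong₂ (λ p q → + 2 * + a * p + q) (eisNorm≡+∣∣ (+ 3 * x - + 2 * z) (+ 3 * y - z))
             (cong₂ (λ e s → + 3 * e * s) D≡ (square≡+∣∣² z)) ⟨
  + 2 * + a * P′ + + 3 * (+ 3 * + b - + 2 * + a) * (z * z)
    ≡⟨ nine (+ a) (+ b) ⟨
  + 9 * (+ a * (+ 2 * (eisNorm x y - x * z)) + + b * (z * z))
    ≡⟨ cong (+ 9 *_) (trans (sym (cong₂ (λ p q → + a * p + + b * q) (H₁-norm x y z) (E₃-form (vec3 x y z) (vec3 x y z))))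
                            norm) ⟩
  + 9 * (+ 2 * + a)
    ≡⟨ trans (ℤ.pos-* 9 (2 ℕ.* a)) (cong (+ 9 *_) (ℤ.pos-* 2 a)) ⟨
  + (9 ℕ.* (2 ℕ.* a))
    ∎)
  where
  P′ : ℤ
  P′ = eisNorm (+ 3 * x - + 2 * z) (+ 3 * y - z)
  D : ℕ
  D = 3 ℕ.* b ℕ.∸ 2 ℕ.* a
  D≡ : + 3 * + b - + 2 * + a ≡ + D
  D≡ = begin
    + 3 * + b - + 2 * + a         ≡⟨ cong₂ _-_ (ℤ.pos-* 3 b) (ℤ.pos-* 2 a) ⟨
    + (3 ℕ.* b) - + (2 ℕ.* a)     ≡⟨ ℤ.m-n≡m⊖n (3 ℕ.* b) (2 ℕ.* a) ⟩
    (3 ℕ.* b) ⊖ (2 ℕ.* a)         ≡⟨ ℤ.⊖-≥ (ℕ.<⇒≤ 2a<3b) ⟩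
    + D                           ∎
  nine : ∀ A B → + 9 * (A * (+ 2 * (eisNorm x y - x * z)) + B * (z * z))
                 ≡ + 2 * A * P′ + + 3 * (+ 3 * B - + 2 * A) * (z * z)
  nine A B = identity A B x y z
    where
    identity : ∀ A B x y z → + 9 * (A * (+ 2 * (x * x - x * y + y * y - x * z)) + B * (z * z))
               ≡ + 2 * A * ((+ 3 * x - + 2 * z) * (+ 3 * x - + 2 * z) - (+ 3 * x - + 2 * z) * (+ 3 * y - z)
                             + (+ 3 * y - z) * (+ 3 * y - z))
                 + + 3 * (+ 3 * B - + 2 * A) * (z * z)
    identity = solve-∀

not-exceptional : ∀ {a b} → Coprime a b → ¬ (a ≡ 1 × b ≡ 1) → ¬ (a ≡ 1 × b ≡ 2) → ¬ (a ≡ 4 × b ≡ 3) →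
                  ¬ (a , b) ∈ exceptional-pairs
not-exceptional _   e₁ _  _  (here refl)                         = e₁ (refl , refl)
not-exceptional _   _  e₂ _  (there (here refl))                 = e₂ (refl , refl)
not-exceptional cop _  _  _  (there (there (here refl)))         with cop (ℕ.∣-refl , ℕ.∣-refl)
... | ()
not-exceptional _   _  _  e₃ (there (there (there (here refl)))) = e₃ (refl , refl)

K₁-column-in-plane : ∀ {a b} x y z → 1 ≤ a → 2 ℕ.* a ℕ.< 3 ℕ.* b → ¬ (a , b) ∈ exceptional-pairs → a ℕ.∣ ∣ z ∣ →
                     lattice-form a b H₁ (vec3 x y z) (vec3 x y z) ≡ + 2 * + a →
                     z ≡ 0ℤ
K₁-column-in-plane {a} {b} x y z 1≤a 2a<3b unexceptional a∣z norm =
  [ ℤ.∣i∣≡0⇒i≡0 , (λ Da≤6 → ⊥-elim (unexceptional (small-discriminant 1≤a 2a<3b Da≤6))) ]′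
    (divisor-square-bound {a} {∣ z ∣} {3 ℕ.* b ℕ.∸ 2 ℕ.* a} {6} 1≤a a∣z
      (2ap+3Dk²≡18a⇒Dk²≤6a {a} {∣ eisNorm (+ 3 * x - + 2 * z) (+ 3 * y - z) ∣} {3 ℕ.* b ℕ.∸ 2 ℕ.* a} {∣ z ∣}
        (K₁-norm-in-ℕ {a} {b} x y z 2a<3b norm)))

K₂-column-in-plane-or-on-axis : ∀ {a b} x y z → 1 ≤ b →
  lattice-form a b H₂ (vec3 x y z) (vec3 x y z) ≡ + 2 * + a →
  z ≡ 0ℤ ⊎ (x ≡ 0ℤ × y ≡ 0ℤ)
K₂-column-in-plane-or-on-axis {a} {b} x y z 1≤b norm =
  Data.Sum.map ℤ.∣i∣≡0⇒i≡0 (λ p≡0 → eisNorm≡0⇒≡0 (trans (eisNorm≡+∣∣ x y) (cong +_ p≡0)))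
    (a[2p]+bk²≡2a⇒k≡0⊎p≡0 {a} {b} {∣ eisNorm x y ∣} {∣ z ∣} 1≤b (ℤ.+-injective (begin
      + (a ℕ.* (2 ℕ.* ∣ eisNorm x y ∣) ℕ.+ b ℕ.* (∣ z ∣ ℕ.* ∣ z ∣))
        ≡⟨ cong₂ _+_ (trans (ℤ.pos-* a (2 ℕ.* ∣ eisNorm x y ∣)) (cong (+ a *_) (ℤ.pos-* 2 ∣ eisNorm x y ∣)))
                     (ℤ.pos-* b (∣ z ∣ ℕ.* ∣ z ∣)) ⟩
      + a * (+ 2 * + ∣ eisNorm x y ∣) + + b * + (∣ z ∣ ℕ.* ∣ z ∣)
        ≡⟨ cong₂ (λ p q → + a * (+ 2 * p) + + b * q) (eisNorm≡+∣∣ x y) (square≡+∣∣² z) ⟨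
      + a * (+ 2 * eisNorm x y) + + b * (z * z)
        ≡⟨ cong₂ (λ p q → + a * p + + b * q) (H₂-norm x y z) (E₃-form (vec3 x y z) (vec3 x y z)) ⟨
      lattice-form a b H₂ (vec3 x y z) (vec3 x y z)
        ≡⟨ norm ⟩
      + 2 * + a
        ≡⟨ ℤ.pos-* 2 a ⟨
      + (2 ℕ.* a)
        ∎)))

-- An axis column c = (0, 0, z) meets the other column c′ only through b·z·z′ = −a; with a ∣ z′ this forces
-- b·z = ±1, against b·z² = 2a.
K₂-column-off-axis : ∀ {a b} x y z x′ y′ z′ → 1 ≤ a → a ℕ.∣ ∣ z′ ∣ → x ≡ 0ℤ → y ≡ 0ℤ →
  lattice-form a b H₂ (vec3 x y z) (vec3 x y z) ≡ + 2 * + a →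
  lattice-form a b H₂ (vec3 x y z) (vec3 x′ y′ z′) ≡ - + a →
  ⊥
K₂-column-off-axis {a} {b} _ _ z x′ y′ z′ 1≤a a∣z′ refl refl norm pair =
  bk₁k₂≡a⇒bk₁²≢2a {a} {b} {∣ z ∣} {∣ z′ ∣} 1≤a a∣z′
    (trans (in-ℕ z z′ (trans (sym (drop-H₂ (vec3 x′ y′ z′))) pair)) (ℤ.∣-i∣≡∣i∣ (+ a)))
    (trans (in-ℕ z z (trans (sym (drop-H₂ (vec3 0ℤ 0ℤ z))) norm)) (ℤ.abs-* (+ 2) (+ a)))
  where
  drop-H₂ : ∀ v → lattice-form a b H₂ (vec3 0ℤ 0ℤ z) v ≡ + b * (z * lookup v 2F)
  drop-H₂ v = begin
    lattice-form a b H₂ (vec3 0ℤ 0ℤ z) v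
      ≡⟨ cong₂ (λ p q → + a * p + + b * q) (H₂-axis z v) (E₃-form (vec3 0ℤ 0ℤ z) v) ⟩
    + a * 0ℤ + + b * (z * lookup v 2F)
      ≡⟨ cong (_+ + b * (z * lookup v 2F)) (ℤ.*-zeroʳ (+ a)) ⟩
    0ℤ + + b * (z * lookup v 2F)
      ≡⟨ ℤ.+-identityˡ _ ⟩
    + b * (z * lookup v 2F)
      ∎
  in-ℕ : ∀ {q} s t → + b * (s * t) ≡ q → b ℕ.* (∣ s ∣ ℕ.* ∣ t ∣) ≡ ∣ q ∣
  in-ℕ s t eq = trans (cong (b ℕ.*_) (sym (ℤ.abs-* s t))) (trans (sym (ℤ.abs-* (+ b) (s * t))) (cong ∣_∣ eq))

K₂-column-in-plane : ∀ {a b} x y z x′ y′ z′ → 1 ≤ a → 1 ≤ b → a ℕ.∣ ∣ z′ ∣ →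
  lattice-form a b H₂ (vec3 x y z) (vec3 x y z) ≡ + 2 * + a →
  lattice-form a b H₂ (vec3 x y z) (vec3 x′ y′ z′) ≡ - + a →
  z ≡ 0ℤ
K₂-column-in-plane {a} {b} x y z x′ y′ z′ 1≤a 1≤b a∣z′ norm pair =
  [ id , (λ (x≡0 , y≡0) → ⊥-elim (K₂-column-off-axis {a} {b} x y z x′ y′ z′ 1≤a a∣z′ x≡0 y≡0 norm pair)) ]′
    (K₂-column-in-plane-or-on-axis {a} {b} x y z 1≤b norm)

-- Enumeration of the block matrices

block : ℤ × ℤ × ℤ × ℤ × ℤ × ℤ × ℤ → Mat
block (x₁ , x₂ , x₃ , y₁ , y₂ , y₃ , ε) = mat x₁ x₂ x₃ y₁ y₂ y₃ 0ℤ 0ℤ ε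

candidates : List Mat
candidates = map block (trits ⊗ trits ⊗ trits ⊗ trits ⊗ trits ⊗ trits ⊗ signs)
  where
  infixr 5 _⊗_
  _⊗_ : {A B : Set} → List A → List B → List (A × B)
  _⊗_ = cartesianProduct

∈-candidates : ∀ {x₁ x₂ x₃ y₁ y₂ y₃ ε} → x₁ ∈ trits → x₂ ∈ trits → x₃ ∈ trits →
               y₁ ∈ trits → y₂ ∈ trits → y₃ ∈ trits → ε ∈ signs →
               mat x₁ x₂ x₃ y₁ y₂ y₃ 0ℤ 0ℤ ε ∈ candidates
∈-candidates x₁∈ x₂∈ x₃∈ y₁∈ y₂∈ y₃∈ ε∈ = ∈-map⁺ block (x₁∈ ⊗ x₂∈ ⊗ x₃∈ ⊗ y₁∈ ⊗ y₂∈ ⊗ y₃∈ ⊗ ε∈)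
  where
  infixr 5 _⊗_
  _⊗_ : {A B : Set} {x : A} {y : B} {xs : List A} {ys : List B} → x ∈ xs → y ∈ ys → (x , y) ∈ cartesianProduct xs ys
  _⊗_ = ∈-cartesianProduct⁺

preserves? : ∀ X M → Dec (Preserves M X)
preserves? X M = ((transpose M · X) · M) ≟ₘ X

blockIsometries : Mat → List Mat
blockIsometries X = filter (preserves? X) candidates

-- The isometry groups of K₁ and K₂ have exponent dividing 6, so M ^ 5 is the inverse of M.
Certificate : Mat → Set
Certificate X = All (λ M → Preserves M E₃ × M · M ^ 5 ≡ I₃ × M ^ 5 · M ≡ I₃) (blockIsometries X)

certificate? : ∀ X → Dec (Certificate X)
certificate? X =
  all? (λ M → preserves? E₃ M ×-dec ((M · M ^ 5) ≟ₘ I₃) ×-dec ((M ^ 5 · M) ≟ₘ I₃)) (blockIsometries X)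

blockIsometries-unique? : ∀ X → Dec (Unique (blockIsometries X))
blockIsometries-unique? X = allPairs? (λ M N → ¬? (M ≟ₘ N)) (blockIsometries X)

blockIsometries-sound : ∀ {G c X d} → IsCombination G c X d E₃ → Certificate X →
                        ∀ M → M ∈ blockIsometries X → IsIsometry G M
blockIsometries-sound {X = X} G≡ certificate M M∈ =
  preserves-combination {M = M} G≡ (proj₂ (∈-filter⁻ (preserves? X) M∈)) (proj₁ facts) , M ^ 5 , proj₂ facts
  where
  facts : Preserves M E₃ × M · M ^ 5 ≡ I₃ × M ^ 5 · M ≡ I₃
  facts = All.lookup certificate M∈

H₁-preserving-block∈candidates : ∀ {x₁ x₂ x₃ y₁ y₂ y₃ ε} → ε ∈ signs →
                                 Preserves (mat x₁ x₂ x₃ y₁ y₂ y₃ 0ℤ 0ℤ ε) H₁ →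
                                 mat x₁ x₂ x₃ y₁ y₂ y₃ 0ℤ 0ℤ ε ∈ candidates
H₁-preserving-block∈candidates {x₁} {x₂} {x₃} {y₁} {y₂} {y₃} {ε} ε∈signs pres =
  ∈-candidates (proj₁ first) (proj₁ second) (proj₁ third) (proj₂ first) (proj₂ second) (proj₂ third) ε∈signs
  where
  M : Mat
  M = mat x₁ x₂ x₃ y₁ y₂ y₃ 0ℤ 0ℤ ε
  diagonal : ∀ i → β H₁ (column M i) (column M i) ≡ entry H₁ i i
  diagonal i = preserved-gram M pres i i
  first : x₁ ∈ trits × y₁ ∈ trits
  first = eisNorm≤1⇒trits (twice≡2⇒∣∣≤1 (trans (sym (H₁-plane-norm x₁ y₁)) (diagonal 0F)))
  second : x₂ ∈ trits × y₂ ∈ trits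
  second = eisNorm≤1⇒trits (twice≡2⇒∣∣≤1 (trans (sym (H₁-plane-norm x₂ y₂)) (diagonal 1F)))
  eisNorm≡x₃ε : eisNorm x₃ y₃ ≡ x₃ * ε
  eisNorm≡x₃ε = ℤ.i-j≡0⇒i≡j _ _ (twice≡0⇒≡0 (trans (sym (H₁-norm x₃ y₃ ε)) (diagonal 2F)))
  third : x₃ ∈ trits × y₃ ∈ trits
  third = eisNorm≤∣x∣⇒trits (ℕ.≤-reflexive (begin
    ∣ eisNorm x₃ y₃ ∣     ≡⟨ cong ∣_∣ eisNorm≡x₃ε ⟩
    ∣ x₃ * ε ∣            ≡⟨ ℤ.abs-* x₃ ε ⟩
    ∣ x₃ ∣ ℕ.* ∣ ε ∣      ≡⟨ cong (∣ x₃ ∣ ℕ.*_) (∣sign∣≡1 ε∈signs) ⟩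
    ∣ x₃ ∣ ℕ.* 1          ≡⟨ ℕ.*-identityʳ ∣ x₃ ∣ ⟩
    ∣ x₃ ∣                ∎))

H₂-preserving-block∈candidates : ∀ {x₁ x₂ x₃ y₁ y₂ y₃ ε} → ε ∈ signs →
                                 Preserves (mat x₁ x₂ x₃ y₁ y₂ y₃ 0ℤ 0ℤ ε) H₂ →
                                 mat x₁ x₂ x₃ y₁ y₂ y₃ 0ℤ 0ℤ ε ∈ candidates
H₂-preserving-block∈candidates {x₁} {x₂} {x₃} {y₁} {y₂} {y₃} {ε} ε∈signs pres =
  ∈-candidates (proj₁ first) (proj₁ second) (proj₁ third) (proj₂ first) (proj₂ second) (proj₂ third) ε∈signs
  where
  M : Mat
  M = mat x₁ x₂ x₃ y₁ y₂ y₃ 0ℤ 0ℤ ε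
  diagonal : ∀ i → β H₂ (column M i) (column M i) ≡ entry H₂ i i
  diagonal i = preserved-gram M pres i i
  first : x₁ ∈ trits × y₁ ∈ trits
  first = eisNorm≤1⇒trits (twice≡2⇒∣∣≤1 (trans (sym (H₂-norm x₁ y₁ 0ℤ)) (diagonal 0F)))
  second : x₂ ∈ trits × y₂ ∈ trits
  second = eisNorm≤1⇒trits (twice≡2⇒∣∣≤1 (trans (sym (H₂-norm x₂ y₂ 0ℤ)) (diagonal 1F)))
  third : x₃ ∈ trits × y₃ ∈ trits
  third = eisNorm≤1⇒trits
    (ℕ.≤-trans (ℕ.≤-reflexive (cong ∣_∣ (twice≡0⇒≡0 (trans (sym (H₂-norm x₃ y₃ ε)) (diagonal 2F))))) ℕ.z≤n)

plane-preserving⇒∈blockIsometries : ∀ {G c X d} .{{_ : NonZero c}} → IsCombination G c X d E₃ →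
  (∀ {x₁ x₂ x₃ y₁ y₂ y₃ ε} → ε ∈ signs → Preserves (mat x₁ x₂ x₃ y₁ y₂ y₃ 0ℤ 0ℤ ε) X →
   mat x₁ x₂ x₃ y₁ y₂ y₃ 0ℤ 0ℤ ε ∈ candidates) →
  ∀ {x₁ x₂ x₃ y₁ y₂ y₃ z₁ z₂ z₃ N} → z₁ ≡ 0ℤ → z₂ ≡ 0ℤ →
  Preserves (mat x₁ x₂ x₃ y₁ y₂ y₃ z₁ z₂ z₃) G → mat x₁ x₂ x₃ y₁ y₂ y₃ z₁ z₂ z₃ · N ≡ I₃ →
  mat x₁ x₂ x₃ y₁ y₂ y₃ z₁ z₂ z₃ ∈ blockIsometries X
plane-preserving⇒∈blockIsometries {X = X} G≡ bounded {x₁} {x₂} {x₃} {y₁} {y₂} {y₃} {z₃ = ε} {mat _ _ _ _ _ _ _ _ n}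
                                  refl refl pres MN =
  ∈-filter⁺ (preserves? X) (bounded {x₁} {x₂} {x₃} {y₁} {y₂} {y₃} {ε} ε∈signs X-preserved) X-preserved
  where
  ε∈signs : ε ∈ signs
  ε∈signs = unit⇒∈signs {n = n} (trans (sym (ℤ.+-identityˡ (ε * n))) (cong (λ P → entry P 2F 2F) MN))
  X-preserved : Preserves (mat x₁ x₂ x₃ y₁ y₂ y₃ 0ℤ 0ℤ ε) X
  X-preserved = preserves-component {M = mat x₁ x₂ x₃ y₁ y₂ y₃ 0ℤ 0ℤ ε} G≡ pres
                  (bottom-row-preserves-E₃ x₁ x₂ x₃ y₁ y₂ y₃ ε∈signs)

K₁-complete : ∀ {a b} → 1 ≤ a → 2 ℕ.* a ℕ.< 3 ℕ.* b → Coprime a b → ¬ (a , b) ∈ exceptional-pairs →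
              ∀ M → IsIsometry (K₁ a b) M → M ∈ blockIsometries H₁
K₁-complete {a} {b} 1≤a 2a<3b cop unexceptional M@(mat x₁ x₂ _ y₁ y₂ _ z₁ z₂ _) (pres , N , MN , _) =
  plane-preserving⇒∈blockIsometries {{ℤ.>-nonZero (ℤ.+<+ 1≤a)}} (K₁-combination a b) H₁-preserving-block∈candidates
    {N = N} z₁≡0 z₂≡0 pres MN
  where
  divisible : a ℕ.∣ ∣ z₁ ∣ × a ℕ.∣ ∣ z₂ ∣
  divisible = K₁-third-row-divisible {a} {b} {M} {N} cop pres MN
  gram : ∀ i j → lattice-form a b H₁ (column M i) (column M j) ≡ entry (K₁ a b) i j
  gram = preserved-gram-combination (K₁-combination a b) M pres
  z₁≡0 : z₁ ≡ 0ℤ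
  z₁≡0 = K₁-column-in-plane {a} {b} x₁ y₁ z₁ 1≤a 2a<3b unexceptional (proj₁ divisible) (gram 0F 0F)
  z₂≡0 : z₂ ≡ 0ℤ
  z₂≡0 = K₁-column-in-plane {a} {b} x₂ y₂ z₂ 1≤a 2a<3b unexceptional (proj₂ divisible) (gram 1F 1F)

K₂-complete : ∀ {a b} → 1 ≤ a → 1 ≤ b → Coprime a b → ∀ M → IsIsometry (K₂ a b) M → M ∈ blockIsometries H₂
K₂-complete {a} {b} 1≤a 1≤b cop M@(mat x₁ x₂ _ y₁ y₂ _ z₁ z₂ _) (pres , N , MN , _) =
  plane-preserving⇒∈blockIsometries {{ℤ.>-nonZero (ℤ.+<+ 1≤a)}} (K₂-combination a b) H₂-preserving-block∈candidates
    {N = N} z₁≡0 z₂≡0 pres MN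
  where
  divisible : a ℕ.∣ ∣ z₁ ∣ × a ℕ.∣ ∣ z₂ ∣
  divisible = K₂-third-row-divisible {a} {b} {M} {N} cop pres MN
  gram : ∀ i j → lattice-form a b H₂ (column M i) (column M j) ≡ entry (K₂ a b) i j
  gram = preserved-gram-combination (K₂-combination a b) M pres
  z₁≡0 : z₁ ≡ 0ℤ
  z₁≡0 = K₂-column-in-plane {a} {b} x₁ y₁ z₁ x₂ y₂ z₂ 1≤a 1≤b (proj₂ divisible) (gram 0F 0F) (gram 0F 1F)
  z₂≡0 : z₂ ≡ 0ℤ
  z₂≡0 = K₂-column-in-plane {a} {b} x₂ y₂ z₂ x₁ y₁ z₁ 1≤a 1≤b (proj₁ divisible) (gram 1F 1F) (gram 1F 0F)

lemma4p1 : (a b : ℕ) → 1 ≤ a → 1 ≤ b → Coprime a b →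
    HasCard (IsIsometry (K₂ a b)) 24
    × (PosDef (K₁ a b) → ¬ (a ≡ 1 × b ≡ 1) → ¬ (a ≡ 1 × b ≡ 2) → ¬ (a ≡ 4 × b ≡ 3) →
       HasCard (IsIsometry (K₁ a b)) 12)
lemma4p1 a b 1≤a 1≤b cop =
  (blockIsometries H₂ , refl , toWitness {a? = blockIsometries-unique? H₂} tt ,
   λ M → K₂-complete 1≤a 1≤b cop M ,
         blockIsometries-sound (K₂-combination a b) (toWitness {a? = certificate? H₂} tt) M) ,
  λ posdef e₁ e₂ e₃ →
  blockIsometries H₁ , refl , toWitness {a? = blockIsometries-unique? H₁} tt ,
  λ M → K₁-complete 1≤a (posdef⇒2a<3b posdef) cop (not-exceptional cop e₁ e₂ e₃) M ,
        blockIsometries-sound (K₁-combination a b) (toWitness {a? = certificate? H₁} tt) M
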